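{- Let $P$ and $Q$ be partitions of strings $x$ and $y$ into $j$ parts $P_1,\dots,P_j$ and $Q_1,\dots,Q_j$ respectively. If $(P,Q)$ is edit-preserving, then $\Delta_{\text{ed}}(x,y)=\sum_{i=1}^j\Delta_{\text{ed}}(P_i,Q_i)$.
   Context: $\Delta_{\text{ed}}$ is edit distance (minimum number of insertions, deletions, substitutions). A partition of a string into $j$ parts is a division into $j$ consecutive contiguous substrings $P_1,\dots,P_j$ whose concatenation is the string. Fix an optimal sequence of edits from $x$ to $y$. A letter of $x$ or $y$ is touched if it is involved in an edit, or if an insertion or deletion occurs immediately to its right. A letter $a$ of $x$ is siblings with a letter $b$ of $y$ if either $a,b$ are the first letters of $x,y$, or the edits map $a$ to $b$ while leaving both untouched. The pair $(P,Q)$ is edit-preserving if there exists an optimal sequence of edits from $x$ to $y$ under which, for each $i$, the first letter of $P_i$ is siblings with the first letter of $Q_i$. -}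

module Defs where

open import Level using (Level)
open import Data.Nat using (ℕ; zero; suc; _+_; _⊓_)
open import Data.List using (List; []; _∷_; length; map; _++_; foldr)
open import Data.Vec using (Vec; []; _∷_)
open import Data.Fin using (Fin; zero; suc)
open import Data.Product using (_×_)
open import Data.Sum using (_⊎_)
open import Data.Empty using (⊥)
open import Data.Unit using (⊤)
open import Relation.Nullary using (¬_; yes; no)
open import Relation.Binary.Definitions using (DecidableEquality)
open import Relation.Binary.PropositionalEquality using (_≡_; refl)

private variable
  ℓ : Level
  A : Set ℓ

-- An alignment ("sequence of edits" read left-to-right) from x to y.
-- match : letter kept unchanged (cost 0); sub : substitution (cost 1);
-- del : deletion of a letter of x (cost 1); ins : insertion of a letter of y (cost 1).
data Script {A : Set ℓ} : List A → List A → Set ℓ where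
  done  : Script [] []
  match : ∀ {xs ys} (a : A) → Script xs ys → Script (a ∷ xs) (a ∷ ys)
  sub   : ∀ {xs ys} (a b : A) → Script xs ys → Script (a ∷ xs) (b ∷ ys)
  del   : ∀ {xs ys} (a : A) → Script xs ys → Script (a ∷ xs) ys
  ins   : ∀ {xs ys} (b : A) → Script xs ys → Script xs (b ∷ ys)

cost : ∀ {x y : List A} → Script x y → ℕ
cost done        = 0
cost (match a s) = cost s
cost (sub a b s) = suc (cost s)
cost (del a s)   = suc (cost s)
cost (ins b s)   = suc (cost s)

scripts : {A : Set ℓ} → DecidableEquality A → (x y : List A) → List (Script x y)
scripts _≟_ [] [] = done ∷ []
scripts _≟_ [] (b ∷ ys) = map (ins b) (scripts _≟_ [] ys)
scripts _≟_ (a ∷ xs) [] = map (del a) (scripts _≟_ xs [])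
scripts _≟_ (a ∷ xs) (b ∷ ys) =
  matches (a ≟ b)
  ++ map (sub a b) (scripts _≟_ xs ys)
  ++ map (del a) (scripts _≟_ xs (b ∷ ys))
  ++ map (ins b) (scripts _≟_ (a ∷ xs) ys)
  where
  matches : Relation.Nullary.Dec (a ≡ b) → List (Script (a ∷ xs) (b ∷ ys))
  matches (yes refl) = map (match a) (scripts _≟_ xs ys)
  matches (no _)     = []

-- The initial value
-- length x + length y is the cost of the "delete everything, insert everything"
-- script, which is among the enumerated ones, so this is exactly the minimum.
ed : {A : Set ℓ} → DecidableEquality A → List A → List A → ℕ
ed _≟_ x y = foldr _⊓_ (length x + length y) (map cost (scripts _≟_ x y))

nextInsDel : ∀ {x y : List A} → Script x y → Set
nextInsDel done        = ⊥
nextInsDel (match _ _) = ⊥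
nextInsDel (sub _ _ _) = ⊥
nextInsDel (del _ _)   = ⊤
nextInsDel (ins _ _)   = ⊤

-- touchedX s i : the letter of x at position i (0-based) is touched by s:
-- it is substituted/deleted, or an insertion/deletion occurs immediately to its right.
touchedX : ∀ {x y : List A} → Script x y → ℕ → Set
touchedX done i = ⊥
touchedX (match _ s) zero = nextInsDel s
touchedX (match _ s) (suc i) = touchedX s i
touchedX (sub _ _ s) zero = ⊤
touchedX (sub _ _ s) (suc i) = touchedX s i
touchedX (del _ s) zero = ⊤
touchedX (del _ s) (suc i) = touchedX s i
touchedX (ins _ s) i = touchedX s i

-- touchedY s j : the letter of y at position j is touched by s:
-- it is a substituted/inserted letter, or an insertion/deletion occurs immediately to its right.
touchedY : ∀ {x y : List A} → Script x y → ℕ → Set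
touchedY done j = ⊥
touchedY (match _ s) zero = nextInsDel s
touchedY (match _ s) (suc j) = touchedY s j
touchedY (sub _ _ s) zero = ⊤
touchedY (sub _ _ s) (suc j) = touchedY s j
touchedY (ins _ s) zero = ⊤
touchedY (ins _ s) (suc j) = touchedY s j
touchedY (del _ s) j = touchedY s j

mapsTo : ∀ {x y : List A} → Script x y → ℕ → ℕ → Set
mapsTo done i j = ⊥
mapsTo (match _ s) zero zero = ⊤
mapsTo (match _ s) zero (suc j) = ⊥
mapsTo (match _ s) (suc i) zero = ⊥
mapsTo (match _ s) (suc i) (suc j) = mapsTo s i j
mapsTo (sub _ _ s) zero j = ⊥
mapsTo (sub _ _ s) (suc i) zero = ⊥
mapsTo (sub _ _ s) (suc i) (suc j) = mapsTo s i j
mapsTo (del _ s) zero j = ⊥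
mapsTo (del _ s) (suc i) j = mapsTo s i j
mapsTo (ins _ s) i zero = ⊥
mapsTo (ins _ s) i (suc j) = mapsTo s i j

Siblings : ∀ {x y : List A} → Script x y → ℕ → ℕ → Set
Siblings s i j = (i ≡ 0 × j ≡ 0) ⊎ (mapsTo s i j × ¬ touchedX s i × ¬ touchedY s j)

Optimal : {A : Set ℓ} → DecidableEquality A → ∀ {x y : List A} → Script x y → Set
Optimal _≟_ {x} {y} s = cost s ≡ ed _≟_ x y

firstPos : ∀ {j} → Vec (List A) j → Fin j → ℕ
firstPos (p ∷ ps) zero = 0
firstPos (p ∷ ps) (suc i) = length p + firstPos ps i

NonEmpty : List A → Set
NonEmpty [] = ⊥
NonEmpty (_ ∷ _) = ⊤

IsPartition : ∀ {j} → Vec (List A) j → List A → Set _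
IsPartition P x = Data.List.concat (Data.Vec.toList P) ≡ x
  where import Data.Vec
        import Data.List

EditPreserving : {A : Set ℓ} → DecidableEquality A → ∀ {j} {x y : List A} →
                 Vec (List A) j → Vec (List A) j → Set ℓ
EditPreserving _≟_ {j} {x} {y} P Q =
  Data.Product.Σ (Script x y) λ s → Optimal _≟_ s ×
    ((i : Fin j) → NonEmpty (Data.Vec.lookup P i) × NonEmpty (Data.Vec.lookup Q i)
                   × Siblings s (firstPos P i) (firstPos Q i))
  where import Data.Product
        import Data.Vec

module Submission where

-- Write Δ for the edit distance and, for partitions P, Q of x, y into j
-- parts, S for the sum of the Δ(Pᵢ, Qᵢ).  Both inequalities are proved.
--
-- Δ(x, y) ≤ S : optimal scripts Pᵢ → Qᵢ, concatenated, form a script x → y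
--   of cost S, and Δ is a lower bound for the cost of every script.
-- S ≤ Δ(x, y) : take the optimal script s given by edit-preservation.  At
--   every cut but the first, the first letters of P_{i+1} and Q_{i+1} are
--   siblings, and since P₁ is non-empty they do not sit at position 0, so s
--   maps one to the other.  A script from p ++ x′ to q ++ y′ mapping position
--   |p| to position |q| splits as a script p → q followed by a script
--   x′ → y′; splitting s at every cut bounds its cost from below by S.

open import Defs
open import Level using (Level)
open import Data.Nat using (ℕ; zero; suc; _+_; _⊓_; _≤_; z≤n)
open import Data.Nat.Properties
  using (⊓-sel; m≤n⇒m⊓o≤n; m≤n⇒o⊓m≤n; ≤-refl; ≤-antisym; +-mono-≤; +-identityʳ; module ≤-Reasoning)
open import Data.List using (List; []; _∷_; length; map; _++_; concat)
open import Data.List.Properties using (++-identityʳ; foldr-preservesᵒ)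
open import Data.List.Membership.Propositional using (_∈_; lose)
open import Data.List.Membership.Propositional.Properties
  using (∈-map⁺; ∈-map⁻; ∈-++⁺ˡ; ∈-++⁺ʳ; foldr-selective)
open import Data.List.Relation.Unary.Any using (here)
open import Data.Vec using (Vec; zipWith; sum; []; _∷_; toList; lookup)
open import Data.Fin using (Fin; zero; suc)
open import Data.Product using (Σ; _×_; _,_; proj₁; proj₂)
open import Data.Sum using (_⊎_; inj₁; inj₂; [_,_])
open import Function using (_∘_)
open import Data.Unit using (⊤; tt)
open import Data.Empty using (⊥-elim)
open import Relation.Nullary using (yes; no)
open import Relation.Binary.Definitions using (DecidableEquality)
open import Relation.Binary.PropositionalEquality
  using (_≡_; refl; sym; trans; cong; cong₂; subst; subst₂)

∈-++³ : ∀ {a} {X : Set a} {t : X} (S D : List X) {I : List X} →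
        t ∈ S ⊎ t ∈ D ⊎ t ∈ I → t ∈ S ++ D ++ I
∈-++³ S D = [ ∈-++⁺ˡ , ∈-++⁺ʳ S ∘ [ ∈-++⁺ˡ , ∈-++⁺ʳ D ] ]

module _ {ℓ : Level} {A : Set ℓ} where

  eraseAll : ∀ (x y : List A) → Script x y
  eraseAll (a ∷ x) y       = del a (eraseAll x y)
  eraseAll []      (b ∷ y) = ins b (eraseAll [] y)
  eraseAll []      []      = done

  cost-eraseAll : ∀ x y → cost (eraseAll x y) ≡ length x + length y
  cost-eraseAll (a ∷ x) y       = cong suc (cost-eraseAll x y)
  cost-eraseAll []      (b ∷ y) = cong suc (cost-eraseAll [] y)
  cost-eraseAll []      []      = refl

  _++ₛ_ : ∀ {x₁ y₁ x₂ y₂ : List A} → Script x₁ y₁ → Script x₂ y₂ → Script (x₁ ++ x₂) (y₁ ++ y₂)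
  done      ++ₛ t = t
  match a s ++ₛ t = match a (s ++ₛ t)
  sub a b s ++ₛ t = sub a b (s ++ₛ t)
  del a s   ++ₛ t = del a (s ++ₛ t)
  ins b s   ++ₛ t = ins b (s ++ₛ t)

  cost-++ₛ : ∀ {x₁ y₁ x₂ y₂ : List A} (s : Script x₁ y₁) (t : Script x₂ y₂) →
             cost (s ++ₛ t) ≡ cost s + cost t
  cost-++ₛ done        t = refl
  cost-++ₛ (match a s) t = cost-++ₛ s t
  cost-++ₛ (sub a b s) t = cong suc (cost-++ₛ s t)
  cost-++ₛ (del a s)   t = cong suc (cost-++ₛ s t)
  cost-++ₛ (ins b s)   t = cong suc (cost-++ₛ s t)

  mapsTo-++ₛ : ∀ {x₁ y₁ x₂ y₂ : List A} (s : Script x₁ y₁) (t : Script x₂ y₂) {i j : ℕ} →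
               mapsTo (s ++ₛ t) (length x₁ + i) (length y₁ + j) → mapsTo t i j
  mapsTo-++ₛ done        t m = m
  mapsTo-++ₛ (match a s) t m = mapsTo-++ₛ s t m
  mapsTo-++ₛ (sub a b s) t m = mapsTo-++ₛ s t m
  mapsTo-++ₛ (del a s)   t m = mapsTo-++ₛ s t m
  mapsTo-++ₛ (ins b s)   t m = mapsTo-++ₛ s t m

  data SplitAt (p q : List A) {x₂ y₂ : List A} : Script (p ++ x₂) (q ++ y₂) → Set ℓ where
    _⟨++⟩_ : (s₁ : Script p q) (s₂ : Script x₂ y₂) → SplitAt p q (s₁ ++ₛ s₂)

  splitAt : ∀ (p q : List A) {x₂ y₂ : List A} (s : Script (p ++ x₂) (q ++ y₂)) →
            mapsTo s (length p) (length q) → SplitAt p q s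
  splitAt []      []      s           _ = done ⟨++⟩ s
  splitAt []      (b ∷ q) (match _ s) ()
  splitAt []      (b ∷ q) (sub _ _ s) ()
  splitAt []      (b ∷ q) (del _ s)   ()
  splitAt []      (b ∷ q) (ins _ s)   m with splitAt [] q s m
  ... | s₁ ⟨++⟩ s₂ = ins b s₁ ⟨++⟩ s₂
  splitAt (a ∷ p) []      (match _ s) ()
  splitAt (a ∷ p) []      (sub _ _ s) ()
  splitAt (a ∷ p) []      (del _ s)   m with splitAt p [] s m
  ... | s₁ ⟨++⟩ s₂ = del a s₁ ⟨++⟩ s₂
  splitAt (a ∷ p) []      (ins _ s)   ()
  splitAt (a ∷ p) (b ∷ q) (match _ s) m with splitAt p q s m
  ... | s₁ ⟨++⟩ s₂ = match a s₁ ⟨++⟩ s₂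
  splitAt (a ∷ p) (b ∷ q) (sub _ _ s) m with splitAt p q s m
  ... | s₁ ⟨++⟩ s₂ = sub a b s₁ ⟨++⟩ s₂
  splitAt (a ∷ p) (b ∷ q) (del _ s)   m with splitAt p (b ∷ q) s m
  ... | s₁ ⟨++⟩ s₂ = del a s₁ ⟨++⟩ s₂
  splitAt (a ∷ p) (b ∷ q) (ins _ s)   m with splitAt (a ∷ p) q s m
  ... | s₁ ⟨++⟩ s₂ = ins b s₁ ⟨++⟩ s₂

  cost-subst₂ : ∀ {x x′ y y′ : List A} (x≡x′ : x ≡ x′) (y≡y′ : y ≡ y′) (s : Script x y) →
                cost (subst₂ Script x≡x′ y≡y′ s) ≡ cost s
  cost-subst₂ refl refl s = refl

  concatV : ∀ {j} → Vec (List A) j → List A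
  concatV P = concat (toList P)

  CutsMatched : ∀ {j} (P Q : Vec (List A) j) → Script (concatV P) (concatV Q) → Set
  CutsMatched {zero}  P Q s = ⊤
  CutsMatched {suc j} P Q s = (i : Fin j) → mapsTo s (firstPos P (suc i)) (firstPos Q (suc i))

  cutsMatched-tail : ∀ {j} (p q : List A) (P Q : Vec (List A) j)
                     (s₁ : Script p q) (s₂ : Script (concatV P) (concatV Q)) →
                     CutsMatched (p ∷ P) (q ∷ Q) (s₁ ++ₛ s₂) → CutsMatched P Q s₂
  cutsMatched-tail p q []      []      s₁ s₂ _    = tt
  cutsMatched-tail p q (_ ∷ _) (_ ∷ _) s₁ s₂ cuts = λ i → mapsTo-++ₛ s₁ s₂ (cuts (suc i))

  siblings-suc⇒mapsTo : ∀ {x y : List A} (s : Script x y) {i j : ℕ} →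
                        Siblings s (suc i) j → mapsTo s (suc i) j
  siblings-suc⇒mapsTo s (inj₁ (() , _))
  siblings-suc⇒mapsTo s (inj₂ (mapped , _)) = mapped

  -- The sibling condition of edit-preservation implies that all cuts but the
  -- first are matched: the first part is non-empty, so the later parts start
  -- at non-zero positions.
  siblings⇒cutsMatched : ∀ {j} (P Q : Vec (List A) j) (s : Script (concatV P) (concatV Q)) →
                         ((i : Fin j) → NonEmpty (lookup P i) × NonEmpty (lookup Q i)
                                        × Siblings s (firstPos P i) (firstPos Q i)) →
                         CutsMatched P Q s
  siblings⇒cutsMatched []             []      s _        = tt
  siblings⇒cutsMatched ([] ∷ P)       (q ∷ Q) s siblings = ⊥-elim (proj₁ (siblings zero))
  siblings⇒cutsMatched ((_ ∷ _) ∷ P) (q ∷ Q) s siblings =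
    λ i → siblings-suc⇒mapsTo s (proj₂ (proj₂ (siblings (suc i))))

module _ {ℓ : Level} {A : Set ℓ} (_≟_ : DecidableEquality A) where

  Δ : List A → List A → ℕ
  Δ = ed _≟_

  ∈-scripts-∷∷ : ∀ {a b : A} {xs ys : List A} {t : Script (a ∷ xs) (b ∷ ys)} →
                 t ∈ map (sub a b) (scripts _≟_ xs ys)
                   ⊎ t ∈ map (del a) (scripts _≟_ xs (b ∷ ys))
                   ⊎ t ∈ map (ins b) (scripts _≟_ (a ∷ xs) ys) →
                 t ∈ scripts _≟_ (a ∷ xs) (b ∷ ys)
  ∈-scripts-∷∷ {a} {b} {xs} {ys} t∈block with a ≟ b
  ... | yes refl = ∈-++⁺ʳ (map (match a) (scripts _≟_ xs ys)) (∈-++³ _ _ t∈block)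
  ... | no _     = ∈-++³ _ _ t∈block

  scripts-complete : ∀ {x y : List A} (s : Script x y) → s ∈ scripts _≟_ x y
  scripts-complete done = here refl
  scripts-complete (match a s) with a ≟ a
  ... | yes refl = ∈-++⁺ˡ (∈-map⁺ (match a) (scripts-complete s))
  ... | no a≢a   = ⊥-elim (a≢a refl)
  scripts-complete (sub a b s) = ∈-scripts-∷∷ (inj₁ (∈-map⁺ (sub a b) (scripts-complete s)))
  scripts-complete {y = []}    (del a s) = ∈-map⁺ (del a) (scripts-complete s)
  scripts-complete {y = _ ∷ _} (del a s) = ∈-scripts-∷∷ (inj₂ (inj₁ (∈-map⁺ (del a) (scripts-complete s))))
  scripts-complete {x = []}    (ins b s) = ∈-map⁺ (ins b) (scripts-complete s)
  scripts-complete {x = _ ∷ _} (ins b s) = ∈-scripts-∷∷ (inj₂ (inj₂ (∈-map⁺ (ins b) (scripts-complete s))))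

  ed-≤-cost : ∀ {x y : List A} (s : Script x y) → Δ x y ≤ cost s
  ed-≤-cost {x} {y} s =
    foldr-preservesᵒ min-≤ (length x + length y) (map cost (scripts _≟_ x y))
      (inj₂ (lose (∈-map⁺ cost (scripts-complete s)) ≤-refl))
    where
    min-≤ : ∀ m n → m ≤ cost s ⊎ n ≤ cost s → m ⊓ n ≤ cost s
    min-≤ m n = [ m≤n⇒m⊓o≤n n , m≤n⇒o⊓m≤n m ]

  -- Δ is attained: since ⊓ is selective, the minimum is either the initial
  -- value, the cost of `eraseAll`, or the cost of an enumerated script.
  ed-attained : ∀ (x y : List A) → Σ (Script x y) λ s → cost s ≡ Δ x y
  ed-attained x y with foldr-selective ⊓-sel (length x + length y) (map cost (scripts _≟_ x y))
  ... | inj₁ Δ≡init = eraseAll x y , trans (cost-eraseAll x y) (sym Δ≡init)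
  ... | inj₂ Δ∈costs with ∈-map⁻ cost Δ∈costs
  ...   | s , _ , Δ≡cost = s , sym Δ≡cost

  optimalPieces : ∀ {j} (P Q : Vec (List A) j) →
                  Σ (Script (concatV P) (concatV Q)) λ s → cost s ≡ sum (zipWith Δ P Q)
  optimalPieces []      []      = done , refl
  optimalPieces (p ∷ P) (q ∷ Q) with ed-attained p q | optimalPieces P Q
  ... | s , s-opt | t , t-cost = s ++ₛ t , trans (cost-++ₛ s t) (cong₂ _+_ s-opt t-cost)

  ed-≤-sum : ∀ {j} (P Q : Vec (List A) j) → Δ (concatV P) (concatV Q) ≤ sum (zipWith Δ P Q)
  ed-≤-sum P Q with optimalPieces P Q
  ... | s , s-cost = subst (_ ≤_) s-cost (ed-≤-cost s)

  sum-≤-cost-∷ : ∀ {j} (p q : List A) (P Q : Vec (List A) j)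
                 (s : Script (concatV (p ∷ P)) (concatV (q ∷ Q))) →
                 CutsMatched (p ∷ P) (q ∷ Q) s → sum (zipWith Δ (p ∷ P) (q ∷ Q)) ≤ cost s
  sum-≤-cost-∷ p q [] [] s _ =
    subst₂ _≤_ (sym (+-identityʳ (Δ p q))) (cost-subst₂ p++[]≡p q++[]≡q s)
      (ed-≤-cost (subst₂ Script p++[]≡p q++[]≡q s))
    where
    p++[]≡p : p ++ [] ≡ p
    p++[]≡p = ++-identityʳ p
    q++[]≡q : q ++ [] ≡ q
    q++[]≡q = ++-identityʳ q
  sum-≤-cost-∷ p q (p′ ∷ P) (q′ ∷ Q) s cuts
    with splitAt p q s (subst₂ (mapsTo s) (+-identityʳ _) (+-identityʳ _) (cuts zero))
  ... | s₁ ⟨++⟩ s₂ = begin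
    Δ p q + sum (zipWith Δ (p′ ∷ P) (q′ ∷ Q)) ≤⟨ +-mono-≤ (ed-≤-cost s₁) restBound ⟩
    cost s₁ + cost s₂                         ≡⟨ sym (cost-++ₛ s₁ s₂) ⟩
    cost (s₁ ++ₛ s₂)                          ∎
    where
    open ≤-Reasoning
    restBound : sum (zipWith Δ (p′ ∷ P) (q′ ∷ Q)) ≤ cost s₂
    restBound = sum-≤-cost-∷ p′ q′ P Q s₂ (cutsMatched-tail p q (p′ ∷ P) (q′ ∷ Q) s₁ s₂ cuts)

  sum-≤-cost : ∀ {j} (P Q : Vec (List A) j) (s : Script (concatV P) (concatV Q)) →
               CutsMatched P Q s → sum (zipWith Δ P Q) ≤ cost s
  sum-≤-cost []      []      s _    = z≤n
  sum-≤-cost (p ∷ P) (q ∷ Q) s cuts = sum-≤-cost-∷ p q P Q s cuts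

lemma26 : ∀ {ℓ : Level} {A : Set ℓ} (_≟_ : DecidableEquality A) (j : ℕ)
            (x y : List A) (P Q : Vec (List A) j) →
            IsPartition P x → IsPartition Q y →
            EditPreserving _≟_ {j} {x} {y} P Q →
            ed _≟_ x y ≡ sum (zipWith (ed _≟_) P Q)
lemma26 _≟_ j _ _ P Q refl refl (s , s-optimal , siblings) =
  ≤-antisym (ed-≤-sum _≟_ P Q) lowerBound
  where
  lowerBound : sum (zipWith (ed _≟_) P Q) ≤ ed _≟_ (concatV P) (concatV Q)
  lowerBound = subst (_ ≤_) s-optimal
                 (sum-≤-cost _≟_ P Q s (siblings⇒cutsMatched P Q s siblings))
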